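{- Let $S$ be a solid and let $x\in S$ with $x\ne e(x)$. Then (1) $e(x^2)\le x^2$, and equality holds if and only if $x=e(x)$; (2) $e(u(x))<u(x)$.
   Context: A solid is a set $S$ with binary operations $+$ and $\cdot$ and a relation $\le$ satisfying: (1) $+$ is associative and commutative; for every $x$ there is a unique $e$ with $x+e=x$ and $e+f=e$ whenever $x+f=x$, written $e(x)$ (the magnitude of $x$); for every $x$ there is $s$ with $x+s=e(x)$ and $e(s)=e(x)$, written $-x$; $e(x+y)=e(x)$ or $e(x+y)=e(y)$. (2) $\cdot$ is associative and commutative; for every $x\ne e(x)$ there is a unique $u$ with $xu=x$ and $uv=u$ whenever $xv=x$, written $u(x)$; for every $x\ne e(x)$ there is $d$ with $xd=u(x)$ and $u(d)=u(x)$, written $x^{ -1}$; for $x\ne e(x),y\ne e(y)$: $u(xy)=u(x)$ or $u(xy)=u(y)$. (3) $\le$ is a total order; $x\le y\Rightarrow x+z\le y+z$; $y+e(x)=e(x)\Rightarrow (y\le e(x)$ and $-y\le e(x))$; $(e(x)<x$ and $y\le z)\Rightarrow xy\le xz$; $e(y)\le y\le z\Rightarrow e(x)y\le e(x)z$. (4) For all $x,y$ there is $z$ with $e(x)y=e(z)$; $e(xy)=e(x)y+e(y)x$; for $x\ne e(x)$, $e(u(x))=e(x)x^{ -1}$; $xy+xz=x(y+z)+e(x)y+e(x)z$; $-(xy)=(-x)y$. (5) There is $0$ with $0+x=x$ for all $x$; there is $1$ with $1x=x$ for all $x$; there is $M$ with $e(x)+M=M$ for all $x$; there is $x$ with $e(x)\ne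 0$ and $e(x)\ne M$; for every $x$ there is $a$ with $x=a+e(x)$ and $e(a)=0$; if $x=e(x)$, $y=e(y)$ and $x<y$ then there is $z\ne e(z)$ with $x<z<y$. Here $x^2=xx$. -}

module Defs where

open import Data.Product using (_×_; ∃-syntax)
open import Data.Sum using (_⊎_)
open import Relation.Binary.PropositionalEquality using (_≡_; _≢_)
open import Relation.Binary.Structures using (IsTotalOrder)

-- The magnitude e(x), the opposite -x, the unit u(x) and the inverse x⁻¹
-- are given as operations satisfying the defining properties.  u and ⁻¹
-- are total functions whose specification is only required for
-- x ≢ e x (their values elsewhere are irrelevant and never used).
record Solid : Set₁ where
  infixl 6 _+_
  infixl 7 _·_
  infix 4 _≤_ _<_
  field
    Carrier : Set
    _+_ _·_ : Carrier → Carrier → Carrier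
    _≤_     : Carrier → Carrier → Set
    e       : Carrier → Carrier
    -_      : Carrier → Carrier
    u       : Carrier → Carrier
    _⁻¹     : Carrier → Carrier

  _<_ : Carrier → Carrier → Set
  x < y = x ≤ y × x ≢ y

  field
    +-assoc : ∀ x y z → (x + y) + z ≡ x + (y + z)
    +-comm  : ∀ x y → x + y ≡ y + x
    e-neutral : ∀ x → x + e x ≡ x
    e-minimal : ∀ x f → x + f ≡ x → e x + f ≡ e x
    neg-inv   : ∀ x → x + (- x) ≡ e x
    e-neg     : ∀ x → e (- x) ≡ e x
    e-sum     : ∀ x y → e (x + y) ≡ e x ⊎ e (x + y) ≡ e y
    ·-assoc : ∀ x y z → (x · y) · z ≡ x · (y · z)
    ·-comm  : ∀ x y → x · y ≡ y · x
    u-neutral : ∀ x → x ≢ e x → x · u x ≡ x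
    u-minimal : ∀ x → x ≢ e x → ∀ v → x · v ≡ x → u x · v ≡ u x
    inv-inv   : ∀ x → x ≢ e x → x · (x ⁻¹) ≡ u x
    u-inv     : ∀ x → x ≢ e x → u (x ⁻¹) ≡ u x
    u-prod    : ∀ x y → x ≢ e x → y ≢ e y → u (x · y) ≡ u x ⊎ u (x · y) ≡ u y
    ≤-isTotalOrder : IsTotalOrder _≡_ _≤_
    +-mono-≤  : ∀ x y z → x ≤ y → x + z ≤ y + z
    absorbed-≤ : ∀ x y → y + e x ≡ e x → (y ≤ e x × - y ≤ e x)
    ·-mono-≤  : ∀ x y z → e x < x → y ≤ z → x · y ≤ x · z
    e·-mono-≤ : ∀ x y z → e y ≤ y → y ≤ z → e x · y ≤ e x · z
    e·-magnitude : ∀ x y → ∃[ z ] (e x · y ≡ e z)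
    e-prod    : ∀ x y → e (x · y) ≡ e x · y + e y · x
    e-u       : ∀ x → x ≢ e x → e (u x) ≡ e x · (x ⁻¹)
    distrib   : ∀ x y z → x · y + x · z ≡ x · (y + z) + e x · y + e x · z
    neg-·     : ∀ x y → - (x · y) ≡ (- x) · y
    𝟘 𝟙 M : Carrier
    𝟘-identity : ∀ x → 𝟘 + x ≡ x
    𝟙-identity : ∀ x → 𝟙 · x ≡ x
    M-absorbs  : ∀ x → e x + M ≡ M
    nontrivial : ∃[ x ] (e x ≢ 𝟘 × e x ≢ M)
    decompose  : ∀ x → ∃[ a ] (x ≡ a + e x × e a ≡ 𝟘)
    dense      : ∀ x y → x ≡ e x → y ≡ e y → x < y →
                 ∃[ z ] (z ≢ e z × x < z × z < y)

  _² : Carrier → Carrier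
  x ² = x · x

module Submission where

-- Magnitudes are additively idempotent, so e(x·x) = e(x)x + e(x)x collapses to x·e(x); for
-- x > e(x) monotonicity of multiplication by x then gives e(x²) = x·e(x) ≤ x·x, and the case
-- x < e(x) reduces to this one via (-x)² = x².  Equality would make x = x²·x⁻¹ = e(x²)·x⁻¹ a
-- magnitude.  For (2), with w = x² > e(w) one finds w·e(u w) = e(w); if u w ≤ e(u w) then
-- w = w·u w ≤ w·e(u w) = e(w) < w; finally u(x²) = u(x).

open import Defs
open import Data.Empty using (⊥-elim)
open import Data.Product using (_×_; _,_; ∃-syntax)
open import Data.Sum using (inj₁; inj₂)
open import Function.Bundles using (_⇔_; mk⇔)
open import Relation.Nullary using (¬_)
open import Relation.Binary.PropositionalEquality
open import Relation.Binary.Structures using (IsTotalOrder)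

module SolidProperties (S : Solid) where
  open Solid S
  open IsTotalOrder ≤-isTotalOrder using (total; antisym; reflexive)
  open ≡-Reasoning

  Magnitude : Carrier → Set
  Magnitude m = ∃[ z ] m ≡ e z

  e-idem : ∀ z → e (e z) ≡ e z
  e-idem z = begin
    e (e z)             ≡⟨ sym (e-minimal (e z) (e z) (e-minimal z (e z) (e-neutral z))) ⟩
    e (e z) + e z       ≡⟨ +-comm _ _ ⟩
    e z + e (e z)       ≡⟨ e-neutral (e z) ⟩
    e z                 ∎

  magnitude-e-fixed : ∀ {m} → Magnitude m → e m ≡ m
  magnitude-e-fixed (z , refl) = e-idem z

  magnitude-+-idem : ∀ {m} → Magnitude m → m + m ≡ m
  magnitude-+-idem (z , refl) = e-minimal z (e z) (e-neutral z)

  e-² : ∀ x → e (x ²) ≡ x · e x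
  e-² x = begin
    e (x · x)           ≡⟨ e-prod x x ⟩
    e x · x + e x · x   ≡⟨ magnitude-+-idem (e·-magnitude x x) ⟩
    e x · x             ≡⟨ ·-comm _ _ ⟩
    x · e x             ∎

  x≡x²·x⁻¹ : ∀ x → x ≢ e x → x ≡ x ² · x ⁻¹
  x≡x²·x⁻¹ x x≢ex = begin
    x                   ≡⟨ sym (u-neutral x x≢ex) ⟩
    x · u x             ≡⟨ cong (x ·_) (sym (inv-inv x x≢ex)) ⟩
    x · (x · x ⁻¹)      ≡⟨ sym (·-assoc _ _ _) ⟩
    (x · x) · x ⁻¹      ∎

  ²-≢-e : ∀ x → x ≢ e x → x ² ≢ e (x ²)
  ²-≢-e x x≢ex x²≡ex² = x≢ex (sym (magnitude-e-fixed x-magnitude))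
    where
    x-magnitude : Magnitude x
    x-magnitude with e·-magnitude (x ²) (x ⁻¹)
    ... | z , ex²·x⁻¹≡ez = z , trans (x≡x²·x⁻¹ x x≢ex)
                                 (trans (cong (_· x ⁻¹) x²≡ex²) ex²·x⁻¹≡ez)

  neg-involutive : ∀ y → - (- y) ≡ y
  neg-involutive y = begin
    - (- y)                   ≡⟨ sym (e-neutral _) ⟩
    - (- y) + e (- (- y))     ≡⟨ cong (- (- y) +_) (trans (e-neg _) (e-neg _)) ⟩
    - (- y) + e y             ≡⟨ cong (- (- y) +_) (trans (sym (neg-inv y)) (+-comm _ _)) ⟩
    - (- y) + (- y + y)       ≡⟨ sym (+-assoc _ _ _) ⟩
    (- (- y) + - y) + y       ≡⟨ cong (_+ y) (+-comm _ _) ⟩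
    (- y + - (- y)) + y       ≡⟨ cong (_+ y) (trans (neg-inv (- y)) (e-neg y)) ⟩
    e y + y                   ≡⟨ +-comm _ _ ⟩
    y + e y                   ≡⟨ e-neutral y ⟩
    y                         ∎

  neg-² : ∀ x → (- x) ² ≡ x ²
  neg-² x = begin
    (- x) · (- x)     ≡⟨ sym (neg-· x (- x)) ⟩
    - (x · (- x))     ≡⟨ cong -_ (·-comm _ _) ⟩
    - ((- x) · x)     ≡⟨ cong -_ (sym (neg-· x x)) ⟩
    - (- (x · x))     ≡⟨ neg-involutive _ ⟩
    x · x             ∎

  neg-+-self : ∀ x → x + - x ≡ e (- x)
  neg-+-self x = trans (neg-inv x) (sym (e-neg x))

  e+neg≡neg : ∀ x → e x + - x ≡ - x
  e+neg≡neg x = trans (+-comm _ _) (trans (cong (- x +_) (sym (e-neg x))) (e-neutral (- x)))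

  neg-positive : ∀ x → x < e x → e (- x) < - x
  neg-positive x (x≤ex , x≢ex) =
      subst₂ _≤_ (neg-+-self x) (e+neg≡neg x) (+-mono-≤ x (e x) (- x) x≤ex)
    , λ e-x≡-x → x≢ex (begin
        x               ≡⟨ sym (e-neutral x) ⟩
        x + e x         ≡⟨ cong (x +_) (trans (sym (e-neg x)) e-x≡-x) ⟩
        x + - x         ≡⟨ neg-inv x ⟩
        e x             ∎)

  positive-e-²-≤ : ∀ x → e x < x → e (x ²) ≤ x ²
  positive-e-²-≤ x ex<x@(ex≤x , _) =
    subst (_≤ x ²) (sym (e-² x)) (·-mono-≤ x (e x) x ex<x ex≤x)

  e-²-≤ : ∀ x → x ≢ e x → e (x ²) ≤ x ²
  e-²-≤ x x≢ex with total x (e x)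
  ... | inj₂ ex≤x = positive-e-²-≤ x (ex≤x , ≢-sym x≢ex)
  ... | inj₁ x≤ex = subst₂ _≤_ (cong e (neg-² x)) (neg-² x)
                      (positive-e-²-≤ (- x) (neg-positive x (x≤ex , x≢ex)))

  ·-e-u≡e : ∀ w → w ≢ e w → w · e (u w) ≡ e w
  ·-e-u≡e w w≢ew = begin
    w · e (u w)         ≡⟨ ·-comm _ _ ⟩
    e (u w) · w         ≡⟨ e-u·≡e·u ⟩
    e w · u w           ≡⟨ e·u≡e ⟩
    e w                 ∎
    where
    e-u·≡e·u : e (u w) · w ≡ e w · u w
    e-u·≡e·u = begin
      e (u w) · w            ≡⟨ cong (_· w) (e-u w w≢ew) ⟩
      (e w · w ⁻¹) · w       ≡⟨ ·-assoc _ _ _ ⟩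
      e w · (w ⁻¹ · w)       ≡⟨ cong (e w ·_) (trans (·-comm _ _) (inv-inv w w≢ew)) ⟩
      e w · u w              ∎
    e·u≡e : e w · u w ≡ e w
    e·u≡e = sym (begin
      e w                          ≡⟨ cong e (sym (u-neutral w w≢ew)) ⟩
      e (w · u w)                  ≡⟨ e-prod w (u w) ⟩
      e w · u w + e (u w) · w      ≡⟨ cong (e w · u w +_) e-u·≡e·u ⟩
      e w · u w + e w · u w        ≡⟨ magnitude-+-idem (e·-magnitude w (u w)) ⟩
      e w · u w                    ∎)

  positive-u-≰ : ∀ w → e w < w → ¬ (u w ≤ e (u w))
  positive-u-≰ w ew<w@(ew≤w , ew≢w) u≤eu =
    ew≢w (antisym ew≤w (subst₂ _≤_ (u-neutral w w≢ew) (·-e-u≡e w w≢ew)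
                          (·-mono-≤ w (u w) (e (u w)) ew<w u≤eu)))
    where
    w≢ew : w ≢ e w
    w≢ew = ≢-sym ew≢w

  positive-u : ∀ w → e w < w → e (u w) < u w
  positive-u w ew<w with total (e (u w)) (u w)
  ... | inj₁ eu≤u = eu≤u , λ eu≡u → positive-u-≰ w ew<w (reflexive (sym eu≡u))
  ... | inj₂ u≤eu = ⊥-elim (positive-u-≰ w ew<w u≤eu)

  u-² : ∀ x → x ≢ e x → u (x ²) ≡ u x
  u-² x x≢ex with u-prod x x x≢ex x≢ex
  ... | inj₁ p = p
  ... | inj₂ p = p

corollary2p21 : (S : Solid) → let open Solid S in
    ∀ (x : Carrier) → x ≢ e x →
      ((e (x ²) ≤ x ² × (e (x ²) ≡ x ² ⇔ x ≡ e x)) × e (u x) < u x)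
corollary2p21 S x x≢ex =
  (e-²-≤ x x≢ex , mk⇔ (λ ex²≡x² → ⊥-elim (x²≢ex² (sym ex²≡x²))) (λ x≡ex → ⊥-elim (x≢ex x≡ex)))
  , subst (λ v → e v < v) (u-² x x≢ex) (positive-u (x ²) (e-²-≤ x x≢ex , ≢-sym x²≢ex²))
  where
  open Solid S
  open SolidProperties S
  x²≢ex² : x ² ≢ e (x ²)
  x²≢ex² = ²-≢-e x x≢ex
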